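{- Let $q$ be a prime power and $\beta\ge2$. If $\vec{B}=(\vec{b}_1;\dots;\vec{b}_{\beta+1})\in\mathbb{F}_q^{(\beta+1)\times n}$ is a twin-reduced basis of a code $\mathcal{C}$, then with $\ell_i:=|\vec{b}_i^+|$, \[\ell_{\beta+1}\ge\left\lceil\frac{q-1}{q^\beta-q}\cdot\big(s_q(\ell_1,\beta)-\ell_1\big)\right\rceil.\]
   Context: $s_q(d,k)$ is the minimal $n$ such that a linear code in $\mathbb{F}_q^n$ of dimension $k$ and minimum distance $d$ exists. $|\vec{x}|$ Hamming weight. $\pi^\perp_{\{\vec{x}_1,\dots,\vec{x}_m\}}$ zeroes coordinates in the union of supports; $\pi_i:=\pi^\perp_{\{\vec{b}_1,\dots,\vec{b}_{i-1}\}}$, $\vec{b}_i^+:=\pi_i(\vec{b}_i)$, $\vec{B}_{[i,j]}:=(\pi_i(\vec{b}_i);\dots;\pi_i(\vec{b}_j))$. Proper: all epipodal vectors nonzero. Forward reduced: first vector is a shortest nonzero codeword of the generated code. For a code $\mathcal{D}$, $S$ is redundant if $S\subseteq\mathsf{Supp}(\mathcal{D})$ and for all $\vec{c}\in\mathcal{D}$, $i,j\in S$: $c_i=0\iff c_j=0$; $\eta(\mathcal{D})$ is the max size of a redundant set. Backward reduced: proper and the last epipodal vector has length $\eta$ of the generated code. $\vec{B}\in\mathbb{F}_q^{(\beta+1)\times n}$ is twin reduced if $\vec{B}_{[1,\beta]}$ is forward reduced and $\vec{B}_{[2,\beta+1]}$ is backward reduced. -}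

module Defs where

open import Level using (Level; _⊔_; Lift) renaming (suc to lsuc)
open import Data.Nat using (ℕ; zero; suc; _∸_; _≤_; _<_) renaming (_+_ to _+ℕ_)
open import Data.Nat.DivMod using (_/_)
open import Data.Fin using (Fin; zero; suc; inject₁; toℕ)
open import Data.Fin.Subset using (Subset; _∈_; ∣_∣)
open import Data.Bool using (Bool; true; false; if_then_else_; _∨_)
open import Data.Empty using (⊥)
open import Data.Product using (Σ; ∃; _×_; _,_)
open import Relation.Nullary using (¬_; Dec; yes; no)
open import Relation.Binary using (Decidable)
open import Relation.Binary.PropositionalEquality using (_≡_)
open import Algebra.Bundles using (CommutativeRing)

-- We additionally require decidable
-- equality (needed for Hamming weights; automatic for finite fields)
-- and an enumeration Fin q ≅ Carrier (up to the setoid equality),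
-- i.e. the field has exactly q elements.  (Any finite field has prime
-- power order, so q is automatically a prime power and every prime
-- power occurs; this models 𝔽_q.)

record FiniteField (c ℓ : Level) (q : ℕ) : Set (lsuc (c ⊔ ℓ)) where
  field
    commRing    : CommutativeRing c ℓ
  open CommutativeRing commRing public
  field
    0≉1         : ¬ (0# ≈ 1#)
    inverse     : ∀ x → ¬ (x ≈ 0#) → Σ Carrier λ y → (x * y) ≈ 1#
    _≟_         : Decidable _≈_
    enum        : Fin q → Carrier
    enum-inj    : ∀ i j → enum i ≈ enum j → i ≡ j
    enum-surj   : ∀ x → Σ (Fin q) λ i → enum i ≈ x

-- Ceiling division ⌈ a / b ⌉ (b = 0 gives 0; never used with b = 0).

ceilDiv : ℕ → ℕ → ℕ
ceilDiv a zero    = 0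
ceilDiv a (suc b) = (a +ℕ b) / suc b

module _ {c ℓ : Level} {q : ℕ} (F : FiniteField c ℓ q) where
  open FiniteField F using (Carrier; _≈_; _+_; _*_; _-_; 0#; 1#; _≟_)

  Word : ℕ → Set c
  Word n = Fin n → Carrier

  Code : ℕ → Set (lsuc (c ⊔ ℓ))
  Code n = Word n → Set (c ⊔ ℓ)

  IsZeroWord : ∀ {n} → Word n → Set ℓ
  IsZeroWord x = ∀ j → x j ≈ 0#

  isNonzero : Carrier → Bool
  isNonzero a with a ≟ 0#
  ... | yes _ = false
  ... | no  _ = true

  wt : ∀ {n} → Word n → ℕ
  wt {zero}  x = 0
  wt {suc n} x = (if isNonzero (x zero) then 1 else 0) +ℕ wt (λ j → x (suc j))

  dist : ∀ {n} → Word n → Word n → ℕ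
  dist x y = wt (λ j → x j - y j)

  sumF : ∀ {k} → (Fin k → Carrier) → Carrier
  sumF {zero}  f = 0#
  sumF {suc k} f = f zero + sumF (λ i → f (suc i))

  lincomb : ∀ {k n} → (Fin k → Carrier) → (Fin k → Word n) → Word n
  lincomb a B j = sumF (λ i → a i * B i j)

  Span : ∀ {k n} → (Fin k → Word n) → Code n
  Span B x = ∃ λ a → ∀ j → x j ≈ lincomb a B j

  LinIndep : ∀ {k n} → (Fin k → Word n) → Set (c ⊔ ℓ)
  LinIndep B = ∀ a → IsZeroWord (lincomb a B) → ∀ i → a i ≈ 0#

  MinDist : ∀ {n} → Code n → ℕ → Set (c ⊔ ℓ)
  MinDist D d =
    (∃ λ x → ∃ λ y → D x × D y × ¬ (∀ j → x j ≈ y j) × dist x y ≡ d) ×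
    (∀ x y → D x → D y → ¬ (∀ j → x j ≈ y j) → d ≤ dist x y)

  HasCode : ℕ → ℕ → ℕ → Set (c ⊔ ℓ)
  HasCode d k m = ∃ λ (G : Fin k → Word m) → LinIndep G × MinDist (Span G) d

  IsSq : ℕ → ℕ → ℕ → Set (c ⊔ ℓ)
  IsSq d k s = HasCode d k s × (∀ m → m < s → ¬ HasCode d k m)

  inSupps : ∀ {m n} → (Fin m → Word n) → Fin n → Bool
  inSupps {zero}  S j = false
  inSupps {suc m} S j = isNonzero (S zero j) ∨ inSupps (λ i → S (suc i)) j

  projPerp : ∀ {m n} → (Fin m → Word n) → Word n → Word n
  projPerp S x j = if inSupps S j then 0# else x j

  -- the first (toℕ i) rows b_1,…,b_{i-1} (0-based: rows with index < i)
  prefix : ∀ {k n} → (Fin k → Word n) → (i : Fin k) → Fin (toℕ i) → Word n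
  prefix {suc k} B zero    ()
  prefix {suc k} B (suc i) zero    = B zero
  prefix {suc k} B (suc i) (suc t) = prefix (λ r → B (suc r)) i t

  proj : ∀ {k n} → (Fin k → Word n) → Fin k → Word n → Word n
  proj B i = projPerp (prefix B i)

  epi : ∀ {k n} → (Fin k → Word n) → Fin k → Word n
  epi B i = proj B i (B i)

  Proper : ∀ {k n} → (Fin k → Word n) → Set ℓ
  Proper B = ∀ i → ¬ IsZeroWord (epi B i)

  -- forward reduced: first vector is a shortest nonzero codeword
  -- (for a basis with no vectors there is no first vector; never used)
  ForwardReduced : ∀ {k n} → (Fin k → Word n) → Set (c ⊔ ℓ)
  ForwardReduced {zero}  B = Lift (c ⊔ ℓ) ⊥
  ForwardReduced {suc k} B =
    ¬ IsZeroWord (B zero) ×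
    (∀ x → Span B x → ¬ IsZeroWord x → wt (B zero) ≤ wt x)

  InSupp : ∀ {n} → Code n → Fin n → Set (c ⊔ ℓ)
  InSupp D j = ∃ λ x → D x × ¬ (x j ≈ 0#)

  Redundant : ∀ {n} → Code n → Subset n → Set (c ⊔ ℓ)
  Redundant D S =
    (∀ j → j ∈ S → InSupp D j) ×
    (∀ x → D x → ∀ i j → i ∈ S → j ∈ S →
       ((x i ≈ 0# → x j ≈ 0#) × (x j ≈ 0# → x i ≈ 0#)))

  IsEta : ∀ {n} → Code n → ℕ → Set (c ⊔ ℓ)
  IsEta D e = (∃ λ S → Redundant D S × ∣ S ∣ ≡ e) ×
              (∀ S → Redundant D S → ∣ S ∣ ≤ e)

  lastIx : ∀ k → Fin (suc k)
  lastIx zero    = zero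
  lastIx (suc k) = suc (lastIx k)

  BackwardReduced : ∀ {k n} → (Fin k → Word n) → Set (c ⊔ ℓ)
  BackwardReduced {zero}  B = Lift _ ⊥
  BackwardReduced {suc k} B = Proper B × IsEta (Span B) (wt (epi B (lastIx k)))

  -- blocks of B = (b_1;…;b_{β+1})  (rows 0-indexed 0,…,β)
  -- B_[1,β] = (π_1 b_1; …; π_1 b_β), where π_1 = π^⊥ of the empty family
  headBlock : ∀ {β n} → (Fin (suc β) → Word n) → Fin β → Word n
  headBlock B t = proj B zero (B (inject₁ t))

  tailBlock : ∀ {β n} → (Fin (suc β) → Word n) → Fin β → Word n
  tailBlock {suc β} B t = proj B (suc zero) (B (suc t))

  TwinReduced : ∀ {β n} → (Fin (suc β) → Word n) → Set (c ⊔ ℓ)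
  TwinReduced B = ForwardReduced (headBlock B) × BackwardReduced (tailBlock B)

  -- ℓ_i = |b_i^+|   (i : Fin k, 0-indexed)
  epiLen : ∀ {k n} → (Fin k → Word n) → Fin k → ℕ
  epiLen B i = wt (epi B i)

module Submission where

-- Puncturing the code spanned by b₁,…,b_β to its support gives a linear code of dimension β
-- and some length m; its minimum distance is ℓ₁ because B_[1,β] is forward reduced, so s ≤ m.
-- A coordinate of that support lies in supp b₁ or in the set T where b₁ vanishes and one of
-- b₂,…,b_β does not, which is the support of the first β − 1 rows of B_[2,β+1]; so s − ℓ₁ ≤ |T|.
-- To bound |T|, scale the column of B_[2,β+1] at each j ∈ T by the q − 1 nonzero scalars. For
-- each j these are q − 1 distinct vectors of 𝔽_q^β whose first β − 1 entries are not all zero,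
-- which leaves q^β − q possible values. Coordinates whose scaled columns share a value have
-- proportional columns, so they form a redundant set of the code of B_[2,β+1], of size at most
-- η = ℓ_{β+1}. Double counting gives (q − 1)|T| ≤ (q^β − q) η.

open import Defs
open import Level using (Level)
open import Function using (_∘_)
open import Data.Bool as Bool using (Bool; true; false; if_then_else_; not; _∨_)
open import Data.Nat using (ℕ; zero; suc; _∸_; _^_; _≤_; z≤n; s≤s)
open import Data.Nat.Properties as ℕₚ using (+-*-semiring)
open import Data.Fin as Fin using (Fin; zero; suc; inject₁; fromℕ; funToFin; finToFun)
open import Data.Fin.Properties using (any?; 0≢1+n; suc-injective; finToFun-funToFin)
open import Data.Fin.Relation.Unary.Top using (view; ‵fromℕ; ‵inject₁)
open import Data.Fin.Subset using (Subset; _∈_; ∣_∣)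
open import Data.Product using (∃; _×_; _,_; proj₁; proj₂)
open import Data.Empty using (⊥-elim)
open import Data.Vec using (tabulate)
open import Data.Vec.Properties using (lookup∘tabulate; []=⇒lookup)
open import Data.Vec.Functional using (Vector; insertAt; replicate)
open import Data.Vec.Functional.Properties using (insertAt-lookup)
open import Relation.Binary.PropositionalEquality as ≡
  using (_≡_; refl; cong; cong₂; module ≡-Reasoning)
open import Relation.Nullary using (¬_; Dec; yes; no; does; ¬?; _×-dec_)
open import Relation.Nullary.Decidable using (dec-true)
open import Relation.Unary using (Decidable)
open import Algebra.Properties.Semiring.Sum +-*-semiring
  using (sum; sum-cong-≗; ∑-comm; ∑-distrib-+; *-distribˡ-sum; *-distribʳ-sum)

does≡true⇒ : ∀ {p} {P : Set p} (P? : Dec P) → does P? ≡ true → P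
does≡true⇒ (yes P) _ = P
does≡true⇒ (no _)  ()

∈tabulate⇒ : ∀ {n} (p : Fin n → Bool) {j} → j ∈ tabulate p → p j ≡ true
∈tabulate⇒ p {j} j∈p = ≡.trans (≡.sym (lookup∘tabulate p j)) ([]=⇒lookup j∈p)

insertAt-fromℕ-inject₁ : ∀ {a} {A : Set a} {n} (xs : Vector A n) v (j : Fin n) →
                         insertAt xs (fromℕ n) v (inject₁ j) ≡ xs j
insertAt-fromℕ-inject₁ xs v zero    = refl
insertAt-fromℕ-inject₁ xs v (suc j) = insertAt-fromℕ-inject₁ (xs ∘ suc) v j

funToFin-injective : ∀ {m n} (f g : Fin m → Fin n) → funToFin f ≡ funToFin g → ∀ i → f i ≡ g i
funToFin-injective f g eq i = begin
  f i                       ≡⟨ finToFun-funToFin f i ⟨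
  finToFun (funToFin f) i   ≡⟨ cong (λ k → finToFun k i) eq ⟩
  finToFun (funToFin g) i   ≡⟨ finToFun-funToFin g i ⟩
  g i                       ∎
  where open ≡-Reasoning

module Counting where
  open import Data.Nat using (_+_; _*_)
  open import Data.Nat.Properties using (+-mono-≤; ≤-trans; ≤-reflexive; m≤m+n; m≤n+m; *-identityʳ)

  𝟙 : Bool → ℕ
  𝟙 b = if b then 1 else 0

  count : ∀ {n} → (Fin n → Bool) → ℕ
  count p = sum (λ i → 𝟙 (p i))

  𝟙≤1 : ∀ b → 𝟙 b ≤ 1
  𝟙≤1 true  = s≤s z≤n
  𝟙≤1 false = z≤n

  𝟙*𝟙≤ : ∀ b c {m} → (b ≡ true → c ≡ true → 1 ≤ m) → 𝟙 b * 𝟙 c ≤ m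
  𝟙*𝟙≤ true  true  1≤m = 1≤m refl refl
  𝟙*𝟙≤ true  false _   = z≤n
  𝟙*𝟙≤ false _     _   = z≤n

  sum-mono-≤ : ∀ {n} {f g : Fin n → ℕ} → (∀ i → f i ≤ g i) → sum f ≤ sum g
  sum-mono-≤ {zero}  f≤g = z≤n
  sum-mono-≤ {suc n} f≤g = +-mono-≤ (f≤g zero) (sum-mono-≤ (f≤g ∘ suc))

  term≤sum : ∀ {n} (f : Fin n → ℕ) i → f i ≤ sum f
  term≤sum f zero    = m≤m+n (f zero) _
  term≤sum f (suc i) = ≤-trans (term≤sum (f ∘ suc) i) (m≤n+m _ (f zero))

  sum-const : ∀ n c → sum {n} (λ _ → c) ≡ n * c
  sum-const zero    c = refl
  sum-const (suc n) c = cong (c +_) (sum-const n c)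

  ∑-comm₄ : ∀ {a b c d} (f : Fin a → Fin b → Fin c → Fin d → ℕ) →
            sum (λ i → sum (λ j → sum (λ k → sum (λ l → f i j k l)))) ≡
            sum (λ k → sum (λ l → sum (λ i → sum (λ j → f i j k l))))
  ∑-comm₄ f = begin
    sum (λ i → sum (λ j → sum (λ k → sum (λ l → f i j k l))))
      ≡⟨ sum-cong-≗ (λ i → ∑-comm (λ j k → sum (λ l → f i j k l))) ⟩
    sum (λ i → sum (λ k → sum (λ j → sum (λ l → f i j k l))))
      ≡⟨ ∑-comm (λ i k → sum (λ j → sum (λ l → f i j k l))) ⟩
    sum (λ k → sum (λ i → sum (λ j → sum (λ l → f i j k l))))
      ≡⟨ sum-cong-≗ (λ k → sum-cong-≗ (λ i → ∑-comm (λ j l → f i j k l))) ⟩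
    sum (λ k → sum (λ i → sum (λ l → sum (λ j → f i j k l))))
      ≡⟨ sum-cong-≗ (λ k → ∑-comm (λ i l → sum (λ j → f i j k l))) ⟩
    sum (λ k → sum (λ l → sum (λ i → sum (λ j → f i j k l)))) ∎
    where open ≡-Reasoning

  count-≢ : ∀ {n} (i₀ : Fin n) → count (λ i → not (does (i Fin.≟ i₀))) ≡ n ∸ 1
  count-≢ {suc n}       zero     = ≡.trans (sum-const n 1) (*-identityʳ n)
  count-≢ {suc (suc n)} (suc i₀) = cong suc (count-≢ i₀)

  count-none : ∀ {n p} {P : Fin n → Set p} (P? : Decidable P) →
               (∀ i → ¬ P i) → count (λ i → does (P? i)) ≡ 0
  count-none {zero}  P? ¬P = refl
  count-none {suc n} P? ¬P with P? zero
  ... | yes P0 = ⊥-elim (¬P zero P0)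
  ... | no  _  = count-none (P? ∘ suc) (¬P ∘ suc)

  count≤1 : ∀ {n p} {P : Fin n → Set p} (P? : Decidable P) →
            (∀ {i j} → P i → P j → i ≡ j) → count (λ i → does (P? i)) ≤ 1
  count≤1 {zero}  P? unique = z≤n
  count≤1 {suc n} P? unique with P? zero
  ... | yes P0 = ≤-reflexive (cong suc (count-none (P? ∘ suc) λ i Pi → 0≢1+n (unique P0 Pi)))
  ... | no  _  = count≤1 (P? ∘ suc) (λ Pi Pj → suc-injective (unique Pi Pj))

  count≤any : ∀ {n p} {P : Fin n → Set p} (P? : Decidable P) →
              (∀ {i j} → P i → P j → i ≡ j) →
              count (λ i → does (P? i)) ≤ 𝟙 (does (any? P?))
  count≤any P? unique with any? P?
  ... | yes _  = count≤1 P? unique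
  ... | no  ¬∃ = ≤-reflexive (count-none P? λ i Pi → ¬∃ (i , Pi))

  ∣tabulate∣ : ∀ {n} (p : Fin n → Bool) → ∣ tabulate p ∣ ≡ count p
  ∣tabulate∣ {zero}  p = refl
  ∣tabulate∣ {suc n} p with p zero
  ... | true  = cong suc (∣tabulate∣ (p ∘ suc))
  ... | false = ∣tabulate∣ (p ∘ suc)

  embed : ∀ {n} (p : Fin n → Bool) → Fin (count p) → Fin n
  embed {suc n} p i with p zero
  embed {suc n} p zero    | true  = zero
  embed {suc n} p (suc i) | true  = suc (embed (p ∘ suc) i)
  embed {suc n} p i       | false = suc (embed (p ∘ suc) i)

  embed-surjective : ∀ {n} (p : Fin n → Bool) {j} → p j ≡ true → ∃ λ i → embed p i ≡ j
  embed-surjective {suc n} p {j} pj with p zero in p0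
  embed-surjective {suc n} p {zero}  pj | true = zero , refl
  embed-surjective {suc n} p {suc j} pj | true with embed-surjective (p ∘ suc) pj
  ... | i , refl = suc i , refl
  embed-surjective {suc n} p {zero}  pj | false with () ← ≡.trans (≡.sym pj) p0
  embed-surjective {suc n} p {suc j} pj | false with embed-surjective (p ∘ suc) pj
  ... | i , refl = i , refl

open Counting

module _ {c ℓ : Level} {q : ℕ} (F : FiniteField c ℓ q) where
  open FiniteField F hiding (zero; refl; sym; trans; reflexive)
  open FiniteField F using ()
    renaming (refl to ≈-refl; sym to ≈-sym; trans to ≈-trans; reflexive to ≈-reflexive)
  open import Data.Nat using () renaming (_+_ to _+ℕ_; _*_ to _*ℕ_)
  import Relation.Binary.Reasoning.Setoid setoid as ≈-Reasoning
  open import Algebra.Properties.Ring ring using (-1*x≈-x; x[y-z]≈xy-xz; [y-z]x≈yx-zx; -0#≈0#)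
  open import Algebra.Properties.Group +-group using (x∙y⁻¹≈ε⇒x≈y; x≈y⇒x∙y⁻¹≈ε)
  open import Algebra.Properties.CommutativeSemigroup *-commutativeSemigroup using (x∙yz≈y∙xz)
  import Algebra.Properties.Semiring.Sum semiring as 𝔽

  x*y≈0⇒y≈0 : ∀ {x y} → ¬ x ≈ 0# → x * y ≈ 0# → y ≈ 0#
  x*y≈0⇒y≈0 {x} {y} x≉0 xy≈0 = begin
    y              ≈⟨ *-identityˡ y ⟨
    1# * y         ≈⟨ *-congʳ (≈-trans (*-comm x⁻¹ x) xx⁻¹≈1) ⟨
    (x⁻¹ * x) * y  ≈⟨ *-assoc x⁻¹ x y ⟩
    x⁻¹ * (x * y)  ≈⟨ *-congˡ xy≈0 ⟩
    x⁻¹ * 0#       ≈⟨ zeroʳ x⁻¹ ⟩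
    0#             ∎
    where
    open ≈-Reasoning
    x⁻¹ = proj₁ (inverse x x≉0)
    xx⁻¹≈1 = proj₂ (inverse x x≉0)

  *-cancelʳ-≉0 : ∀ {x y z} → ¬ z ≈ 0# → x * z ≈ y * z → x ≈ y
  *-cancelʳ-≉0 {x} {y} {z} z≉0 xz≈yz = x∙y⁻¹≈ε⇒x≈y x y (x*y≈0⇒y≈0 z≉0 (begin
    z * (x - y)    ≈⟨ x[y-z]≈xy-xz z x y ⟩
    z * x - z * y  ≈⟨ +-cong (*-comm z x) (-‿cong (*-comm z y)) ⟩
    x * z - y * z  ≈⟨ x≈y⇒x∙y⁻¹≈ε xz≈yz ⟩
    0#             ∎))
    where open ≈-Reasoning

  idx : Carrier → Fin q
  idx x = proj₁ (enum-surj x)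

  enum-idx : ∀ x → enum (idx x) ≈ x
  enum-idx x = proj₂ (enum-surj x)

  idx-injective : ∀ {x y} → idx x ≡ idx y → x ≈ y
  idx-injective {x} {y} eq = begin
    x              ≈⟨ enum-idx x ⟨
    enum (idx x)   ≡⟨ cong enum eq ⟩
    enum (idx y)   ≈⟨ enum-idx y ⟩
    y              ∎
    where open ≈-Reasoning

  isNonzero≡false : ∀ {x} → x ≈ 0# → isNonzero F x ≡ false
  isNonzero≡false {x} x≈0 with x ≟ 0#
  ... | yes _   = refl
  ... | no  x≉0 = ⊥-elim (x≉0 x≈0)

  isNonzero≡true : ∀ {x} → ¬ x ≈ 0# → isNonzero F x ≡ true
  isNonzero≡true {x} x≉0 with x ≟ 0#
  ... | yes x≈0 = ⊥-elim (x≉0 x≈0)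
  ... | no  _   = refl

  isNonzero≡false⇒≈0 : ∀ {x} → isNonzero F x ≡ false → x ≈ 0#
  isNonzero≡false⇒≈0 {x} eq with x ≟ 0#
  isNonzero≡false⇒≈0 {x} eq | yes x≈0 = x≈0
  isNonzero≡false⇒≈0 {x} () | no  _

  isNonzero≡true⇒≉0 : ∀ {x} → isNonzero F x ≡ true → ¬ x ≈ 0#
  isNonzero≡true⇒≉0 {x} eq with x ≟ 0#
  isNonzero≡true⇒≉0 {x} () | yes _
  isNonzero≡true⇒≉0 {x} eq | no  x≉0 = x≉0

  isNonzero-cong : ∀ {x y} → x ≈ y → isNonzero F x ≡ isNonzero F y
  isNonzero-cong {x} {y} x≈y with y ≟ 0#
  ... | yes y≈0 = isNonzero≡false (≈-trans x≈y y≈0)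
  ... | no  y≉0 = isNonzero≡true (λ x≈0 → y≉0 (≈-trans (≈-sym x≈y) x≈0))

  count-nonzero : count (λ l → isNonzero F (enum l)) ≡ q ∸ 1
  count-nonzero = ≡.trans (sum-cong-≗ (cong 𝟙 ∘ isNonzero-enum)) (count-≢ (idx 0#))
    where
    isNonzero-enum : ∀ l → isNonzero F (enum l) ≡ not (does (l Fin.≟ idx 0#))
    isNonzero-enum l with l Fin.≟ idx 0#
    ... | yes refl = isNonzero≡false (enum-idx 0#)
    ... | no  l≢l₀ = isNonzero≡true λ el≈0 →
      l≢l₀ (enum-inj l (idx 0#) (≈-trans el≈0 (≈-sym (enum-idx 0#))))

  wt-cong : ∀ {n} {x y : Word F n} → (∀ j → x j ≈ y j) → wt F x ≡ wt F y
  wt-cong {zero}  x≈y = refl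
  wt-cong {suc n} x≈y = cong₂ _+ℕ_ (cong 𝟙 (isNonzero-cong (x≈y zero))) (wt-cong (x≈y ∘ suc))

  wt≡count : ∀ {n} (x : Word F n) → wt F x ≡ count (λ j → isNonzero F (x j))
  wt≡count {zero}  x = refl
  wt≡count {suc n} x = cong (𝟙 (isNonzero F (x zero)) +ℕ_) (wt≡count (x ∘ suc))

  wt-embed : ∀ {n} (p : Fin n → Bool) {x : Word F n} →
             (∀ j → p j ≡ false → x j ≈ 0#) → wt F (x ∘ embed p) ≡ wt F x
  wt-embed {zero}  p         vanish = refl
  wt-embed {suc n} p {x} vanish with p zero in p0
  ... | true  = cong (𝟙 (isNonzero F (x zero)) +ℕ_) (wt-embed (p ∘ suc) (vanish ∘ suc))
  ... | false = ≡.trans (wt-embed (p ∘ suc) (vanish ∘ suc))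
                        (cong (λ b → 𝟙 b +ℕ wt F (x ∘ suc)) (≡.sym (isNonzero≡false (vanish zero p0))))

  inSupps≡false⇒≈0 : ∀ {m n} (X : Fin m → Word F n) {j} → inSupps F X j ≡ false → ∀ t → X t j ≈ 0#
  inSupps≡false⇒≈0 {suc m} X {j} eq t with isNonzero F (X zero j) in e
  inSupps≡false⇒≈0 {suc m} X eq zero    | false = isNonzero≡false⇒≈0 e
  inSupps≡false⇒≈0 {suc m} X eq (suc t) | false = inSupps≡false⇒≈0 (X ∘ suc) eq t

  inSupps≡true⇒ : ∀ {m n} (X : Fin m → Word F n) {j} → inSupps F X j ≡ true → ∃ λ t → ¬ X t j ≈ 0#
  inSupps≡true⇒ {suc m} X {j} eq with isNonzero F (X zero j) in e
  ... | true  = zero , isNonzero≡true⇒≉0 e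
  ... | false with inSupps≡true⇒ (X ∘ suc) eq
  ...   | t , Xtj≉0 = suc t , Xtj≉0

  inSupps-cong : ∀ {m n} {X Y : Fin m → Word F n} {j} →
                 (∀ t → X t j ≈ Y t j) → inSupps F X j ≡ inSupps F Y j
  inSupps-cong {zero}  X≈Y = refl
  inSupps-cong {suc m} X≈Y = cong₂ _∨_ (isNonzero-cong (X≈Y zero)) (inSupps-cong (X≈Y ∘ suc))

  inSupps-prefix-cong : ∀ {m n} {X Y : Fin m → Word F n} {j} → (∀ t → X t j ≈ Y t j) →
                        ∀ i → inSupps F (prefix F X i) j ≡ inSupps F (prefix F Y i) j
  inSupps-prefix-cong {suc m} X≈Y zero    = refl
  inSupps-prefix-cong {suc m} X≈Y (suc i) =
    cong₂ _∨_ (isNonzero-cong (X≈Y zero)) (inSupps-prefix-cong (X≈Y ∘ suc) i)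

  module _ {m n} (S : Fin m → Word F n) (x : Word F n) {j : Fin n} where
    projPerp-inside : inSupps F S j ≡ true → projPerp F S x j ≡ 0#
    projPerp-inside = cong (λ b → if b then 0# else x j)

    projPerp-outside : inSupps F S j ≡ false → projPerp F S x j ≡ x j
    projPerp-outside = cong (λ b → if b then 0# else x j)

    projPerp-≈0 : x j ≈ 0# → projPerp F S x j ≈ 0#
    projPerp-≈0 xj≈0 with inSupps F S j
    ... | true  = ≈-refl
    ... | false = xj≈0

  projPerp-cong : ∀ {m m′ n} {S : Fin m → Word F n} {S′ : Fin m′ → Word F n} {x y : Word F n} {j} →
                  inSupps F S j ≡ inSupps F S′ j → x j ≈ y j → projPerp F S x j ≈ projPerp F S′ y j
  projPerp-cong {S = S} {S′} {j = j} eq xj≈yj with inSupps F S j | inSupps F S′ j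
  projPerp-cong refl xj≈yj | true  | true  = ≈-refl
  projPerp-cong refl xj≈yj | false | false = xj≈yj

  module _ {k n} (B : Fin (suc (suc k)) → Word F n) {j : Fin n} where
    tailBlock-outside : B zero j ≈ 0# → ∀ t → tailBlock F B t j ≡ B (suc t) j
    tailBlock-outside b₀≈0 t =
      projPerp-outside (prefix F B (suc zero)) (B (suc t)) (cong (_∨ false) (isNonzero≡false b₀≈0))

    tailBlock-inside : ¬ B zero j ≈ 0# → ∀ t → tailBlock F B t j ≡ 0#
    tailBlock-inside b₀≉0 t =
      projPerp-inside (prefix F B (suc zero)) (B (suc t)) (cong (_∨ false) (isNonzero≡true b₀≉0))

    -- Splitting on B zero j ≟ 0# with 'with' would also abstract it inside isNonzero, hence by-cases.
    epi-tailBlock : ∀ i → epi F B (suc i) j ≈ epi F (tailBlock F B) i j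
    epi-tailBlock i = by-cases (B zero j ≟ 0#)
      where
      T = tailBlock F B
      b₀∨rest = λ b → b ∨ inSupps F (prefix F (B ∘ suc) i) j
      by-cases : Dec (B zero j ≈ 0#) → epi F B (suc i) j ≈ epi F T i j
      by-cases (yes b₀≈0) =
        projPerp-cong {S = prefix F B (suc i)} {prefix F T i} {B (suc i)} {T i}
          (≡.trans (cong b₀∨rest (isNonzero≡false b₀≈0))
                   (inSupps-prefix-cong {X = B ∘ suc} {T} (λ t → T-outside t) i))
          (T-outside i)
        where
        T-outside : ∀ t → B (suc t) j ≈ T t j
        T-outside t = ≈-reflexive (≡.sym (tailBlock-outside b₀≈0 t))
      by-cases (no b₀≉0) = begin
        epi F B (suc i) j
          ≡⟨ projPerp-inside (prefix F B (suc i)) (B (suc i)) (cong b₀∨rest (isNonzero≡true b₀≉0)) ⟩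
        0#
          ≈⟨ projPerp-≈0 (prefix F T i) (T i) (≈-reflexive (tailBlock-inside b₀≉0 i)) ⟨
        epi F T i j ∎
        where open ≈-Reasoning

  lincomb≡sum : ∀ {k n} (a : Fin k → Carrier) (X : Fin k → Word F n) j →
                lincomb F a X j ≡ 𝔽.sum (λ t → a t * X t j)
  lincomb≡sum {zero}  a X j = refl
  lincomb≡sum {suc k} a X j = cong (a zero * X zero j +_) (lincomb≡sum (a ∘ suc) (X ∘ suc) j)

  module _ {k n} (X : Fin k → Word F n) where
    lincomb-≈0 : ∀ a {j} → (∀ t → a t * X t j ≈ 0#) → lincomb F a X j ≈ 0#
    lincomb-≈0 a {j} terms≈0 = begin
      lincomb F a X j               ≡⟨ lincomb≡sum a X j ⟩
      𝔽.sum (λ t → a t * X t j)    ≈⟨ 𝔽.sum-cong-≋ terms≈0 ⟩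
      𝔽.sum (replicate k 0#)       ≈⟨ 𝔽.sum-replicate-zero k ⟩
      0#                            ∎
      where open ≈-Reasoning

    lincomb-sub : ∀ a b j → lincomb F a X j - lincomb F b X j ≈ lincomb F (λ t → a t - b t) X j
    lincomb-sub a b j = begin
      lincomb F a X j - lincomb F b X j  ≡⟨ cong₂ _-_ (lincomb≡sum a X j) (lincomb≡sum b X j) ⟩
      𝔽.sum f - 𝔽.sum g                  ≈⟨ +-congˡ -∑g≈∑-g ⟩
      𝔽.sum f + 𝔽.sum (λ t → - g t)     ≈⟨ 𝔽.∑-distrib-+ f (λ t → - g t) ⟨
      𝔽.sum (λ t → f t - g t)            ≈⟨ 𝔽.sum-cong-≋ (λ t → [y-z]x≈yx-zx (X t j) (a t) (b t)) ⟨
      𝔽.sum (λ t → (a t - b t) * X t j)  ≡⟨ lincomb≡sum (λ t → a t - b t) X j ⟨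
      lincomb F (λ t → a t - b t) X j    ∎
      where
      open ≈-Reasoning
      f g : Fin k → Carrier
      f t = a t * X t j
      g t = b t * X t j
      -∑g≈∑-g : - 𝔽.sum g ≈ 𝔽.sum (λ t → - g t)
      -∑g≈∑-g = begin
        - 𝔽.sum g                 ≈⟨ -1*x≈-x (𝔽.sum g) ⟨
        - 1# * 𝔽.sum g            ≈⟨ 𝔽.*-distribˡ-sum (- 1#) g ⟩
        𝔽.sum (λ t → - 1# * g t)  ≈⟨ 𝔽.sum-cong-≋ (λ t → -1*x≈-x (g t)) ⟩
        𝔽.sum (λ t → - g t)       ∎

  δ : ∀ {k} → Fin k → Fin k → Carrier
  δ i t = if does (t Fin.≟ i) then 1# else 0#

  lincomb-δ : ∀ {k n} (X : Fin k → Word F n) i j → lincomb F (δ i) X j ≈ X i j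
  lincomb-δ X zero j = begin
    1# * X zero j + lincomb F (λ _ → 0#) (X ∘ suc) j
      ≈⟨ +-cong (*-identityˡ (X zero j)) (lincomb-≈0 (X ∘ suc) (λ _ → 0#) (λ t → zeroˡ _)) ⟩
    X zero j + 0#  ≈⟨ +-identityʳ (X zero j) ⟩
    X zero j       ∎
    where open ≈-Reasoning
  lincomb-δ X (suc i) j = begin
    0# * X zero j + lincomb F (δ i) (X ∘ suc) j  ≈⟨ +-cong (zeroˡ (X zero j)) (lincomb-δ (X ∘ suc) i j) ⟩
    0# + X (suc i) j                              ≈⟨ +-identityˡ (X (suc i) j) ⟩
    X (suc i) j                                   ∎
    where open ≈-Reasoning

  module _ {k n} (X : Fin k → Word F n) where
    Span-zero : Span F X (λ _ → 0#)
    Span-zero = (λ _ → 0#) , λ j → ≈-sym (lincomb-≈0 X (λ _ → 0#) (λ t → zeroˡ (X t j)))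

    Span-row : ∀ i → Span F X (X i)
    Span-row i = δ i , λ j → ≈-sym (lincomb-δ X i j)

    Span-proportional : ∀ {α β i j x} → ¬ β ≈ 0# → (∀ t → α * X t i ≈ β * X t j) →
                        Span F X x → x i ≈ 0# → x j ≈ 0#
    Span-proportional {α} {β} {i} {j} {x} β≉0 prop (a , x≈aX) xi≈0 = x*y≈0⇒y≈0 β≉0 (begin
      β * x j                           ≈⟨ *-congˡ (x≈aX j) ⟩
      β * lincomb F a X j               ≡⟨ cong (β *_) (lincomb≡sum a X j) ⟩
      β * 𝔽.sum (λ t → a t * X t j)    ≈⟨ 𝔽.*-distribˡ-sum β (λ t → a t * X t j) ⟩
      𝔽.sum (λ t → β * (a t * X t j))  ≈⟨ 𝔽.sum-cong-≋ swap ⟨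
      𝔽.sum (λ t → α * (a t * X t i))  ≈⟨ 𝔽.*-distribˡ-sum α (λ t → a t * X t i) ⟨
      α * 𝔽.sum (λ t → a t * X t i)    ≡⟨ cong (α *_) (lincomb≡sum a X i) ⟨
      α * lincomb F a X i               ≈⟨ *-congˡ (x≈aX i) ⟨
      α * x i                           ≈⟨ *-congˡ xi≈0 ⟩
      α * 0#                            ≈⟨ zeroʳ α ⟩
      0#                                ∎)
      where
      open ≈-Reasoning
      swap : ∀ t → α * (a t * X t i) ≈ β * (a t * X t j)
      swap t = begin
        α * (a t * X t i)  ≈⟨ x∙yz≈y∙xz α (a t) (X t i) ⟩
        a t * (α * X t i)  ≈⟨ *-congˡ (prop t) ⟩
        a t * (β * X t j)  ≈⟨ x∙yz≈y∙xz β (a t) (X t j) ⟨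
        β * (a t * X t j)  ∎

  LinIndep-init : ∀ {k n} {B : Fin (suc k) → Word F n} → LinIndep F B → LinIndep F (B ∘ inject₁)
  LinIndep-init {k} {B = B} indep a a·B≈0 t = begin
    a t             ≡⟨ insertAt-fromℕ-inject₁ a 0# t ⟨
    a' (inject₁ t)  ≈⟨ indep a' a'·B≈0 (inject₁ t) ⟩
    0#              ∎
    where
    open ≈-Reasoning
    a' : Fin (suc k) → Carrier
    a' = insertAt a (fromℕ k) 0#
    a'·B≈0 : IsZeroWord F (lincomb F a' B)
    a'·B≈0 j = begin
      lincomb F a' B j
        ≡⟨ lincomb≡sum a' B j ⟩
      𝔽.sum (λ r → a' r * B r j)
        ≈⟨ 𝔽.sum-init-last (λ r → a' r * B r j) ⟩
      𝔽.sum (λ t → a' (inject₁ t) * B (inject₁ t) j) + a' (fromℕ k) * B (fromℕ k) j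
        ≈⟨ +-cong (𝔽.sum-cong-≋ (λ t → *-congʳ (≈-reflexive (insertAt-fromℕ-inject₁ a 0# t))))
                  (≈-trans (*-congʳ (≈-reflexive (insertAt-lookup a (fromℕ k) 0#))) (zeroˡ _)) ⟩
      𝔽.sum (λ t → a t * B (inject₁ t) j) + 0#
        ≈⟨ +-identityʳ _ ⟩
      𝔽.sum (λ t → a t * B (inject₁ t) j)
        ≡⟨ lincomb≡sum a (B ∘ inject₁) j ⟨
      lincomb F a (B ∘ inject₁) j
        ≈⟨ a·B≈0 j ⟩
      0# ∎

  IsZeroWord-embed : ∀ {n} (p : Fin n → Bool) {z : Word F n} →
                     (∀ j → p j ≡ false → z j ≈ 0#) → (∀ i → z (embed p i) ≈ 0#) → IsZeroWord F z
  IsZeroWord-embed p off on j with p j in pj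
  ... | false = off j pj
  ... | true with embed-surjective p pj
  ...   | i , refl = on i

  puncture : ∀ {k n} (X : Fin k → Word F n) → Fin k → Word F (count (inSupps F X))
  puncture X t = X t ∘ embed (inSupps F X)

  module _ {k n} (X : Fin k → Word F n) where
    lincomb-outside : ∀ a {j} → inSupps F X j ≡ false → lincomb F a X j ≈ 0#
    lincomb-outside a j∉X =
      lincomb-≈0 X a (λ t → ≈-trans (*-congˡ (inSupps≡false⇒≈0 X j∉X t)) (zeroʳ (a t)))

    wt-lincomb-puncture : ∀ a → wt F (lincomb F a (puncture X)) ≡ wt F (lincomb F a X)
    wt-lincomb-puncture a = wt-embed (inSupps F X) (λ j → lincomb-outside a)

    LinIndep-puncture : LinIndep F X → LinIndep F (puncture X)
    LinIndep-puncture indep a a·X≈0 =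
      indep a (IsZeroWord-embed (inSupps F X) (λ j → lincomb-outside a) a·X≈0)

  module _ {k n} (X : Fin (suc k) → Word F n) (fwd : ForwardReduced F X) where
    private
      p = inSupps F X

    MinDist-puncture : MinDist F (Span F (puncture X)) (wt F (X zero))
    MinDist-puncture =
      (puncture X zero , (λ _ → 0#) , Span-row (puncture X) zero , Span-zero (puncture X) , x₀≉0 , dist-x₀-0)
      , lower
      where
      X₀-outside : ∀ j → p j ≡ false → X zero j ≈ 0#
      X₀-outside j j∉X = inSupps≡false⇒≈0 X j∉X zero

      x₀≉0 : ¬ (∀ i → puncture X zero i ≈ 0#)
      x₀≉0 x₀≈0 = proj₁ fwd (IsZeroWord-embed p X₀-outside x₀≈0)

      dist-x₀-0 : dist F (puncture X zero) (λ _ → 0#) ≡ wt F (X zero)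
      dist-x₀-0 = ≡.trans (wt-cong {y = puncture X zero} (λ i → ≈-trans (+-congˡ -0#≈0#) (+-identityʳ _)))
                          (wt-embed p X₀-outside)

      lower : ∀ x y → Span F (puncture X) x → Span F (puncture X) y → ¬ (∀ i → x i ≈ y i) →
              wt F (X zero) ≤ dist F x y
      lower x y (a , x≈aX) (b , y≈bX) x≉y =
        ≡.subst (wt F (X zero) ≤_) (≡.sym dist≡wt-w) (proj₂ fwd w (d , λ _ → ≈-refl) w≉0)
        where
        d = λ t → a t - b t
        w = lincomb F d X
        x-y≈w : ∀ i → x i - y i ≈ w (embed p i)
        x-y≈w i = ≈-trans (+-cong (x≈aX i) (-‿cong (y≈bX i))) (lincomb-sub (puncture X) a b i)
        dist≡wt-w : dist F x y ≡ wt F w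
        dist≡wt-w = ≡.trans (wt-cong x-y≈w) (wt-lincomb-puncture X d)
        w≉0 : ¬ IsZeroWord F w
        w≉0 w≈0 = x≉y (λ i → x∙y⁻¹≈ε⇒x≈y (x i) (y i) (≈-trans (x-y≈w i) (w≈0 (embed p i))))

  HasCode-puncture : ∀ {k n} {X : Fin (suc k) → Word F n} → LinIndep F X → ForwardReduced F X →
                     HasCode F (wt F (X zero)) (suc k) (count (inSupps F X))
  HasCode-puncture {X = X} indep fwd = puncture X , LinIndep-puncture X indep , MinDist-puncture X fwd

  count-supp-headBlock≤ : ∀ {k n} (B : Fin (suc (suc k)) → Word F n) →
    count (inSupps F (headBlock F B)) ≤ wt F (B zero) +ℕ count (inSupps F (tailBlock F B ∘ inject₁))
  count-supp-headBlock≤ B = begin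
    count (inSupps F (headBlock F B))
      ≤⟨ sum-mono-≤ (λ j → column j (B zero j ≟ 0#)) ⟩
    sum (λ j → 𝟙 (isNonzero F (B zero j)) +ℕ 𝟙 (inSupps F T′ j))
      ≡⟨ ∑-distrib-+ (λ j → 𝟙 (isNonzero F (B zero j))) (λ j → 𝟙 (inSupps F T′ j)) ⟩
    count (λ j → isNonzero F (B zero j)) +ℕ count (inSupps F T′)
      ≡⟨ cong (_+ℕ count (inSupps F T′)) (wt≡count (B zero)) ⟨
    wt F (B zero) +ℕ count (inSupps F T′) ∎
    where
    open ℕₚ.≤-Reasoning
    T′ = tailBlock F B ∘ inject₁
    column : ∀ j → Dec (B zero j ≈ 0#) →
             𝟙 (inSupps F (headBlock F B) j) ≤ 𝟙 (isNonzero F (B zero j)) +ℕ 𝟙 (inSupps F T′ j)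
    column j (yes b₀≈0) = ℕₚ.≤-trans (ℕₚ.≤-reflexive (cong 𝟙 suppH≡suppT′)) (ℕₚ.m≤n+m _ _)
      where
      suppH≡suppT′ : inSupps F (headBlock F B) j ≡ inSupps F T′ j
      suppH≡suppT′ = ≡.trans (cong (_∨ inSupps F (headBlock F B ∘ suc) j) (isNonzero≡false b₀≈0))
        (inSupps-cong (λ t → ≈-reflexive (≡.sym (tailBlock-outside B b₀≈0 (inject₁ t)))))
    column j (no b₀≉0) = ℕₚ.≤-trans (𝟙≤1 _)
      (ℕₚ.≤-trans (ℕₚ.≤-reflexive (cong 𝟙 (≡.sym (isNonzero≡true b₀≉0)))) (ℕₚ.m≤m+n _ _))

  module _ {k n} (X : Fin (suc k) → Word F n) {η : ℕ}
           (η-bound : ∀ S → Redundant F (Span F X) S → ∣ S ∣ ≤ η) where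
    private
      Y : Fin k → Word F n
      Y = X ∘ inject₁

      -- The column of X at j scaled by enum l, encoded through idx and funToFin as its first k
      -- entries and its last entry.
      keyInit : Fin n → Fin q → Fin (q ^ k)
      keyInit j l = funToFin (λ t → idx (enum l * Y t j))

      keyLast : Fin n → Fin q → Fin q
      keyLast j l = idx (enum l * X (fromℕ k) j)

      u₀ : Fin (q ^ k)
      u₀ = funToFin {k} (λ _ → idx 0#)

      Hits : Fin (q ^ k) → Fin q → Fin n → Fin q → Set ℓ
      Hits u μ j l = (inSupps F Y j ≡ true × ¬ enum l ≈ 0#) × (keyInit j l ≡ u × keyLast j l ≡ μ)

      hits? : ∀ u μ j l → Dec (Hits u μ j l)
      hits? u μ j l = (inSupps F Y j Bool.≟ true ×-dec ¬? (enum l ≟ 0#)) ×-dec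
                      (keyInit j l Fin.≟ u ×-dec keyLast j l Fin.≟ μ)

      hits⇒proportional : ∀ {u μ i j l l′} → Hits u μ i l → Hits u μ j l′ →
                          ∀ t → enum l * X t i ≈ enum l′ * X t j
      hits⇒proportional (_ , kᵢ≡u , _) (_ , kⱼ≡u , _) t with view t
      hits⇒proportional (_ , _ , lᵢ≡μ) (_ , _ , lⱼ≡μ) _ | ‵fromℕ =
        idx-injective (≡.trans lᵢ≡μ (≡.sym lⱼ≡μ))
      hits⇒proportional {i = i} {j} {l} {l′} (_ , kᵢ≡u , _) (_ , kⱼ≡u , _) _ | ‵inject₁ s =
        idx-injective (funToFin-injective (λ t → idx (enum l * Y t i)) (λ t → idx (enum l′ * Y t j))
                                          (≡.trans kᵢ≡u (≡.sym kⱼ≡u)) s)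

      hit-unique : ∀ {u μ j l l′} → Hits u μ j l → Hits u μ j l′ → l ≡ l′
      hit-unique {l = l} {l′} hit@((j∈Y , _) , _) hit′ with inSupps≡true⇒ Y j∈Y
      ... | t , Ytj≉0 = enum-inj l l′ (*-cancelʳ-≉0 Ytj≉0 (hits⇒proportional hit hit′ (inject₁ t)))

      no-hit-at-u₀ : ∀ {μ j l} → ¬ Hits u₀ μ j l
      no-hit-at-u₀ {j = j} {l} ((j∈Y , l≉0) , k≡u₀ , _) with inSupps≡true⇒ Y j∈Y
      ... | t , Ytj≉0 = Ytj≉0 (x*y≈0⇒y≈0 l≉0 (idx-injective
        (funToFin-injective (λ t → idx (enum l * Y t j)) (λ _ → idx 0#) k≡u₀ t)))

      HitColumns : Fin (q ^ k) → Fin q → Subset n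
      HitColumns u μ = tabulate (λ j → does (any? (hits? u μ j)))

      hit-column : ∀ {u μ j} → j ∈ HitColumns u μ → ∃ (Hits u μ j)
      hit-column {u} {μ} {j} j∈ = does≡true⇒ (any? (hits? u μ j)) (∈tabulate⇒ _ j∈)

      HitColumns-redundant : ∀ u μ → Redundant F (Span F X) (HitColumns u μ)
      HitColumns-redundant u μ = in-support , same-zeros
        where
        in-support : ∀ j → j ∈ HitColumns u μ → InSupp F (Span F X) j
        in-support j j∈ with hit-column j∈
        ... | _ , (j∈Y , _) , _ with inSupps≡true⇒ Y j∈Y
        ...   | t , Ytj≉0 = Y t , Span-row X (inject₁ t) , Ytj≉0
        same-zeros : ∀ x → Span F X x → ∀ i j → i ∈ HitColumns u μ → j ∈ HitColumns u μ →
                     (x i ≈ 0# → x j ≈ 0#) × (x j ≈ 0# → x i ≈ 0#)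
        same-zeros x x∈X i j i∈ j∈ with hit-column i∈ | hit-column j∈
        ... | _ , hitᵢ | _ , hitⱼ =
          Span-proportional X (proj₂ (proj₁ hitⱼ)) (hits⇒proportional hitᵢ hitⱼ) x∈X ,
          Span-proportional X (proj₂ (proj₁ hitᵢ)) (hits⇒proportional hitⱼ hitᵢ) x∈X

      fibre-bound : ∀ u μ →
                    sum (λ j → count (λ l → does (hits? u μ j l))) ≤ 𝟙 (not (does (u Fin.≟ u₀))) *ℕ η
      fibre-bound u μ with u Fin.≟ u₀
      ... | yes refl = ℕₚ.≤-reflexive (≡.trans
        (sum-cong-≗ (λ j → count-none (hits? u₀ μ j) (λ l → no-hit-at-u₀)))
        (≡.trans (sum-const n 0) (ℕₚ.*-zeroʳ n)))
      ... | no _ = begin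
        sum (λ j → count (λ l → does (hits? u μ j l)))
          ≤⟨ sum-mono-≤ (λ j → count≤any (hits? u μ j) hit-unique) ⟩
        count (λ j → does (any? (hits? u μ j)))
          ≡⟨ ∣tabulate∣ (λ j → does (any? (hits? u μ j))) ⟨
        ∣ HitColumns u μ ∣
          ≤⟨ η-bound (HitColumns u μ) (HitColumns-redundant u μ) ⟩
        η
          ≡⟨ ℕₚ.+-identityʳ η ⟨
        1 *ℕ η ∎
        where open ℕₚ.≤-Reasoning

      scaled-column-hits-key : ∀ j l → 𝟙 (inSupps F Y j) *ℕ 𝟙 (isNonzero F (enum l)) ≤
                            sum (λ u → sum (λ μ → 𝟙 (does (hits? u μ j l))))
      scaled-column-hits-key j l = 𝟙*𝟙≤ (inSupps F Y j) (isNonzero F (enum l)) λ j∈Y l≠0 → begin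
        1                                                  ≡⟨ cong 𝟙 (dec-true (hits? _ _ j l) (hit j∈Y l≠0)) ⟨
        𝟙 (does (hits? (keyInit j l) (keyLast j l) j l))  ≤⟨ term≤sum _ (keyLast j l) ⟩
        sum (λ μ → 𝟙 (does (hits? (keyInit j l) μ j l)))  ≤⟨ term≤sum _ (keyInit j l) ⟩
        sum (λ u → sum (λ μ → 𝟙 (does (hits? u μ j l))))  ∎
        where
        open ℕₚ.≤-Reasoning
        hit : inSupps F Y j ≡ true → isNonzero F (enum l) ≡ true → Hits (keyInit j l) (keyLast j l) j l
        hit j∈Y l≠0 = (j∈Y , isNonzero≡true⇒≉0 l≠0) , refl , refl

      double-count : (q ∸ 1) *ℕ count (inSupps F Y) ≤
                     sum (λ u → sum (λ μ → sum (λ j → count (λ l → does (hits? u μ j l)))))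
      double-count = begin
        (q ∸ 1) *ℕ count (inSupps F Y)
          ≡⟨ ℕₚ.*-comm (q ∸ 1) (count (inSupps F Y)) ⟩
        count (inSupps F Y) *ℕ (q ∸ 1)
          ≡⟨ cong (count (inSupps F Y) *ℕ_) count-nonzero ⟨
        count (inSupps F Y) *ℕ count (λ l → isNonzero F (enum l))
          ≡⟨ *-distribʳ-sum (count (λ l → isNonzero F (enum l))) (λ j → 𝟙 (inSupps F Y j)) ⟩
        sum (λ j → 𝟙 (inSupps F Y j) *ℕ count (λ l → isNonzero F (enum l)))
          ≡⟨ sum-cong-≗ (λ j → *-distribˡ-sum (𝟙 (inSupps F Y j)) (𝟙 ∘ isNonzero F ∘ enum)) ⟩
        sum (λ j → sum (λ l → 𝟙 (inSupps F Y j) *ℕ 𝟙 (isNonzero F (enum l))))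
          ≤⟨ sum-mono-≤ (λ j → sum-mono-≤ (scaled-column-hits-key j)) ⟩
        sum (λ j → sum (λ l → sum (λ u → sum (λ μ → 𝟙 (does (hits? u μ j l))))))
          ≡⟨ ∑-comm₄ (λ j l u μ → 𝟙 (does (hits? u μ j l))) ⟩
        sum (λ u → sum (λ μ → sum (λ j → count (λ l → does (hits? u μ j l))))) ∎
        where open ℕₚ.≤-Reasoning

      sum-fibre-bounds :
        sum (λ u → sum {q} (λ μ → 𝟙 (not (does (u Fin.≟ u₀))) *ℕ η)) ≡ (q ^ suc k ∸ q) *ℕ η
      sum-fibre-bounds = begin
        sum (λ u → sum {q} (λ μ → 𝟙 (not (does (u Fin.≟ u₀))) *ℕ η))
          ≡⟨ sum-cong-≗ (λ u → sum-const q (𝟙 (not (does (u Fin.≟ u₀))) *ℕ η)) ⟩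
        sum (λ u → q *ℕ (𝟙 (not (does (u Fin.≟ u₀))) *ℕ η))
          ≡⟨ *-distribˡ-sum q (λ u → 𝟙 (not (does (u Fin.≟ u₀))) *ℕ η) ⟨
        q *ℕ sum (λ u → 𝟙 (not (does (u Fin.≟ u₀))) *ℕ η)
          ≡⟨ cong (q *ℕ_) (*-distribʳ-sum η (λ u → 𝟙 (not (does (u Fin.≟ u₀))))) ⟨
        q *ℕ (count (λ u → not (does (u Fin.≟ u₀))) *ℕ η)
          ≡⟨ cong (λ m → q *ℕ (m *ℕ η)) (count-≢ u₀) ⟩
        q *ℕ ((q ^ k ∸ 1) *ℕ η)
          ≡⟨ ℕₚ.*-assoc q (q ^ k ∸ 1) η ⟨
        q *ℕ (q ^ k ∸ 1) *ℕ η
          ≡⟨ cong (_*ℕ η) (ℕₚ.*-distribˡ-∸ q (q ^ k) 1) ⟩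
        (q ^ suc k ∸ q *ℕ 1) *ℕ η
          ≡⟨ cong (λ m → (q ^ suc k ∸ m) *ℕ η) (ℕₚ.*-identityʳ q) ⟩
        (q ^ suc k ∸ q) *ℕ η ∎
        where open ≡-Reasoning

    count-supp-init≤ : (q ∸ 1) *ℕ count (inSupps F (X ∘ inject₁)) ≤ (q ^ suc k ∸ q) *ℕ η
    count-supp-init≤ = begin
      (q ∸ 1) *ℕ count (inSupps F Y)
        ≤⟨ double-count ⟩
      sum (λ u → sum (λ μ → sum (λ j → count (λ l → does (hits? u μ j l)))))
        ≤⟨ sum-mono-≤ (λ u → sum-mono-≤ (fibre-bound u)) ⟩
      sum (λ u → sum {q} (λ μ → 𝟙 (not (does (u Fin.≟ u₀))) *ℕ η))
        ≡⟨ sum-fibre-bounds ⟩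
      (q ^ suc k ∸ q) *ℕ η ∎
      where open ℕₚ.≤-Reasoning

open import Data.Nat using (_+_; _*_; s≤s⁻¹)
open import Data.Nat.Properties
  using (≤-trans; ≮⇒≥; m≤n+o⇒m∸n≤o; *-monoʳ-≤; +-monoˡ-≤; +-comm; *-comm; n<1+n; module ≤-Reasoning)
open import Data.Nat.DivMod using (m<n*o⇒m/o<n)

ceilDiv-≤ : ∀ {x} d {η} → x ≤ d * η → ceilDiv x d ≤ η
ceilDiv-≤ zero _ = z≤n
ceilDiv-≤ {x} (suc d) {η} x≤dη = s≤s⁻¹ (m<n*o⇒m/o<n (begin-strict
  x + d          ≤⟨ +-monoˡ-≤ d x≤dη ⟩
  suc d * η + d  ≡⟨ ≡.trans (+-comm _ d) (cong (d +_) (*-comm (suc d) η)) ⟩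
  d + η * suc d  <⟨ n<1+n _ ⟩
  suc η * suc d  ∎))
  where open ≤-Reasoning

-- The hypothesis β ≥ 2 only serves to write β = suc k; for β = 1 the bound is 0 (ceilDiv _ 0 = 0).
mainTheorem15 : ∀ {c ℓ : Level} (q : ℕ) (F : FiniteField c ℓ q) (β n : ℕ) → 2 ≤ β →
    (B : Fin (suc β) → Word F n) → LinIndep F B → TwinReduced F B →
    (s : ℕ) → IsSq F (epiLen F B zero) β s →
    ceilDiv ((q ∸ 1) * (s ∸ epiLen F B zero)) (q ^ β ∸ q) ≤ epiLen F B (lastIx F β)
mainTheorem15 q F (suc k) n (s≤s _) B indep (fwd , _ , isEta) s (_ , minimal) = begin
  ceilDiv ((q ∸ 1) * (s ∸ ℓ₁)) (q ^ suc k ∸ q)  ≤⟨ ceilDiv-≤ (q ^ suc k ∸ q) bound ⟩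
  η                                              ≡⟨ η≡ℓ-last ⟩
  epiLen F B (lastIx F (suc k))                  ∎
  where
  open ≤-Reasoning
  ℓ₁ = epiLen F B zero
  T = tailBlock F B
  η = wt F (epi F T (lastIx F k))
  s≤m : s ≤ count (inSupps F (headBlock F B))
  s≤m = ≮⇒≥ λ m<s → minimal _ m<s
    (HasCode-puncture F {X = headBlock F B} (LinIndep-init F {B = B} indep) fwd)
  s∸ℓ₁≤ : s ∸ ℓ₁ ≤ count (inSupps F (T ∘ inject₁))
  s∸ℓ₁≤ = m≤n+o⇒m∸n≤o s ℓ₁ (≤-trans s≤m (count-supp-headBlock≤ F B))
  bound : (q ∸ 1) * (s ∸ ℓ₁) ≤ (q ^ suc k ∸ q) * η
  bound = ≤-trans (*-monoʳ-≤ (q ∸ 1) s∸ℓ₁≤) (count-supp-init≤ F T (proj₂ isEta))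
  η≡ℓ-last : η ≡ epiLen F B (lastIx F (suc k))
  η≡ℓ-last = wt-cong F λ j → FiniteField.sym F (epi-tailBlock F B {j} (lastIx F k))
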